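{- Let $A$ be an admissible set of addition chains and let $m,n$ be positive integers. If $\delta^A(n)=\delta^A(m)$ and $n$ is $A$-stable, then $m$ is $A$-stable.
   Context: An addition chain for a positive integer $n$ is a sequence $(a_0,\ldots,a_r)$ with $a_0=1$, $a_r=n$, and for every $1\le k\le r$ there exist $0\le i,j<k$ with $a_k=a_i+a_j$; $r$ is its length. For a set $A$ of addition chains, $\ell^A(n)$ is the least length of an addition chain for $n$ belonging to $A$. $\nu_2(n)$ is the number of $1$'s in the binary expansion of $n$. $A$ is admissible if (i) for every $n\ge1$, $\ell^A(n)$ is defined and $\ell^A(n)\le\lfloor\log_2 n\rfloor+\nu_2(n)-1$, and (ii) for every $n\ge1$, $\ell^A(2n)\le\ell^A(n)+1$. The $A$-defect is $\delta^A(n)=\ell^A(n)-\log_2 n$. A positive integer $m$ is $A$-stable if $\ell^A(2^k m)=\ell^A(m)+k$ for all $k\ge0$. -}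

module Defs where

open import Data.Nat using (ℕ; zero; suc; _+_; _*_; _∸_; _^_; _≤_; _<_; ⌊_/2⌋)
open import Data.Nat.DivMod using (_%_)
open import Data.Nat.Logarithm using (⌊log₂_⌋)
open import Data.Fin as Fin using (Fin; toℕ; fromℕ)
open import Data.Product using (Σ; ∃; ∃₂; _×_)
open import Relation.Binary.PropositionalEquality using (_≡_)

record AdditionChain : Set where
  field
    len   : ℕ
    elem  : Fin (suc len) → ℕ
    start : elem Fin.zero ≡ 1
    step  : (k : Fin (suc len)) → 0 < toℕ k →
            ∃₂ λ (i j : Fin (suc len)) → i Fin.< k × j Fin.< k × elem k ≡ elem i + elem j

open AdditionChain public

target : AdditionChain → ℕ
target c = elem c (fromℕ (len c))

ChainSet : Set₁
ChainSet = AdditionChain → Set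

IsℓA : ChainSet → ℕ → ℕ → Set
IsℓA A n r =
  (Σ AdditionChain λ c → A c × target c ≡ n × len c ≡ r) ×
  ((c : AdditionChain) → A c → target c ≡ n → r ≤ len c)

-- ν₂(n): number of 1's in binary expansion (fuel n suffices).
private
  ν-go : ℕ → ℕ → ℕ
  ν-go zero    _ = 0
  ν-go (suc f) n = n % 2 + ν-go f ⌊ n /2⌋

ν₂ : ℕ → ℕ
ν₂ n = ν-go n n

record Admissible (A : ChainSet) : Set where
  field
    defined-bound : (n : ℕ) → 1 ≤ n →
      ∃ λ r → IsℓA A n r × r ≤ ⌊log₂ n ⌋ + ν₂ n ∸ 1
    double : (n : ℕ) → 1 ≤ n → (r r′ : ℕ) →
      IsℓA A n r → IsℓA A (2 * n) r′ → r′ ≤ suc r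

-- δ^A(n) = δ^A(m), i.e. ℓ^A(n) − log₂ n = ℓ^A(m) − log₂ m,
-- equivalently 2^{ℓ^A(n)} / n = 2^{ℓ^A(m)} / m, stated via the (unique) values of ℓ^A.
SameDefect : ChainSet → ℕ → ℕ → Set
SameDefect A n m = (rn rm : ℕ) → IsℓA A n rn → IsℓA A m rm → 2 ^ rn * m ≡ 2 ^ rm * n

Stable : ChainSet → ℕ → Set
Stable A m = (r : ℕ) → IsℓA A m r → (k : ℕ) → IsℓA A (2 ^ k * m) (r + k)

{-# OPTIONS --safe #-}
-- Equal defects mean 2^ℓ(n) · m = 2^ℓ(m) · n, so one of m, n is a power-of-two
-- multiple 2^d of the other with the lengths differing by exactly d.  Stability is
-- inherited by 2^d · n from n.  Conversely, if n = 2^d · m is stable with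
-- ℓ(n) = ℓ(m) + d, then doubling gives ℓ(2^k m) ≤ ℓ(m) + k, while
-- ℓ(m) + d + k = ℓ(2^d · 2^k m) ≤ ℓ(2^k m) + d gives the reverse inequality.
module Submission where

open import Defs
open import Data.Nat using (ℕ; _≤_; suc; _+_; _*_; _^_; s≤s; NonZero)
open import Data.Nat.Properties
open import Data.Sum using (inj₁; inj₂)
open import Data.Product using (∃; _,_)
open import Relation.Binary.PropositionalEquality

private
  variable
    A : ChainSet
    x m n a b r : ℕ

IsℓA-unique : IsℓA A x a → IsℓA A x b → a ≡ b
IsℓA-unique ℓa ℓb = ≤-antisym (least ℓa ℓb) (least ℓb ℓa)
  where
  least : IsℓA A x a → IsℓA A x b → a ≤ b
  least (_ , minimal) ((c , c∈A , target≡ , refl) , _) = minimal c c∈A target≡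

ℓA-exists : Admissible A → 1 ≤ n → ∃ (IsℓA A n)
ℓA-exists adm 1≤n with r , ℓr , _ ← Admissible.defined-bound adm _ 1≤n = r , ℓr

1≤2^k*n : ∀ k → 1 ≤ n → 1 ≤ 2 ^ k * n
1≤2^k*n k 1≤n = *-mono-≤ (m^n>0 2 k) 1≤n

b^k*[b^d*x]≡b^[k+d]*x : ∀ b k d x → b ^ k * (b ^ d * x) ≡ b ^ (k + d) * x
b^k*[b^d*x]≡b^[k+d]*x b k d x = begin
  b ^ k * (b ^ d * x)  ≡⟨ *-assoc (b ^ k) (b ^ d) x ⟨
  b ^ k * b ^ d * x    ≡⟨ cong (_* x) (^-distribˡ-+-* b k d) ⟨
  b ^ (k + d) * x      ∎
  where open ≡-Reasoning

b^[a+d]*m≡b^a*n⇒n≡b^d*m : ∀ b .{{_ : NonZero b}} a d m n →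
  b ^ (a + d) * m ≡ b ^ a * n → n ≡ b ^ d * m
b^[a+d]*m≡b^a*n⇒n≡b^d*m b a d m n eq = *-cancelˡ-≡ n (b ^ d * m) (b ^ a) {{m^n≢0 b a}} (begin
  b ^ a * n            ≡⟨ eq ⟨
  b ^ (a + d) * m      ≡⟨ b^k*[b^d*x]≡b^[k+d]*x b a d m ⟨
  b ^ a * (b ^ d * m)  ∎)
  where open ≡-Reasoning

ℓA-2^j*-≤ : Admissible A → 1 ≤ x → ∀ j →
  IsℓA A x a → IsℓA A (2 ^ j * x) b → b ≤ a + j
ℓA-2^j*-≤ {a = a} adm 1≤x 0 ℓa ℓb = ≤-reflexive (trans
  (IsℓA-unique (subst (λ y → IsℓA _ y _) (*-identityˡ _) ℓb) ℓa) (sym (+-identityʳ a)))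
ℓA-2^j*-≤ {A} {x} {a} {b} adm 1≤x (suc j) ℓa ℓb
  with r , ℓr ← ℓA-exists adm (1≤2^k*n j 1≤x) = begin
  b            ≤⟨ Admissible.double adm _ (1≤2^k*n j 1≤x) r b ℓr ℓb′ ⟩
  suc r        ≤⟨ s≤s (ℓA-2^j*-≤ adm 1≤x j ℓa ℓr) ⟩
  suc (a + j)  ≡⟨ +-suc a j ⟨
  a + suc j    ∎
  where
  open ≤-Reasoning
  ℓb′ : IsℓA A (2 * (2 ^ j * x)) b
  ℓb′ = subst (λ y → IsℓA A y b) (*-assoc 2 (2 ^ j) x) ℓb

Stable-2^* : Admissible A → 1 ≤ n → Stable A n → ∀ d → Stable A (2 ^ d * n)
Stable-2^* {A} {n} adm 1≤n stable d r ℓr k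
  with rn , ℓn ← ℓA-exists adm 1≤n
  with refl ← IsℓA-unique (stable rn ℓn d) ℓr =
  subst₂ (IsℓA A) (sym (b^k*[b^d*x]≡b^[k+d]*x 2 k d n)) lengths (stable rn ℓn (k + d))
  where
  lengths : rn + (k + d) ≡ rn + d + k
  lengths = trans (cong (rn +_) (+-comm k d)) (sym (+-assoc rn d k))

Stable-÷2^ : Admissible A → 1 ≤ m → ∀ d → IsℓA A m r → IsℓA A (2 ^ d * m) (r + d) →
  Stable A (2 ^ d * m) → ∀ k → IsℓA A (2 ^ k * m) (r + k)
Stable-÷2^ {A} {m} {r} adm 1≤m d ℓm ℓ2^dm stable k
  with s , ℓs ← ℓA-exists adm (1≤2^k*n k 1≤m) =
  subst (IsℓA A (2 ^ k * m)) (≤-antisym upper lower) ℓs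
  where
  upper : s ≤ r + k
  upper = ℓA-2^j*-≤ adm 1≤m k ℓm ℓs
  ℓ2^d2^km : IsℓA A (2 ^ d * (2 ^ k * m)) (r + k + d)
  ℓ2^d2^km = subst₂ (IsℓA A)
    (trans (b^k*[b^d*x]≡b^[k+d]*x 2 k d m)
      (trans (cong (λ e → 2 ^ e * m) (+-comm k d)) (sym (b^k*[b^d*x]≡b^[k+d]*x 2 d k m))))
    (trans (+-assoc r d k) (trans (cong (r +_) (+-comm d k)) (sym (+-assoc r k d))))
    (stable (r + d) ℓ2^dm k)
  lower : r + k ≤ s
  lower = +-cancelʳ-≤ d (r + k) s (ℓA-2^j*-≤ adm (1≤2^k*n k 1≤m) d ℓs ℓ2^d2^km)

proposition3p6 : (A : ChainSet) → Admissible A → (m n : ℕ) → 1 ≤ m → 1 ≤ n →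
    SameDefect A n m → Stable A n → Stable A m
proposition3p6 A adm m n 1≤m 1≤n sameDefect stableN r ℓm
  with rn , ℓn ← ℓA-exists adm 1≤n
  with ≤-total r rn
... | inj₁ r≤rn
  with d , refl ← m≤n⇒∃[o]m+o≡n r≤rn
  with refl ← b^[a+d]*m≡b^a*n⇒n≡b^d*m 2 r d m n (sameDefect (r + d) r ℓn ℓm) =
  Stable-÷2^ adm 1≤m d ℓm ℓn stableN
... | inj₂ rn≤r
  with d , refl ← m≤n⇒∃[o]m+o≡n rn≤r
  with refl ← b^[a+d]*m≡b^a*n⇒n≡b^d*m 2 rn d n m (sym (sameDefect rn (rn + d) ℓn ℓm)) =
  Stable-2^* adm 1≤n stableN d (rn + d) ℓm
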